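{- Let $n\ge2$ and let $\alpha_1,\dots,\alpha_n\in2^\omega$ be proper with $0^\omega<_{lex}\alpha_1<_{lex}\alpha_2<_{lex}\dots<_{lex}\alpha_n<_{lex}1^\omega$. Then $s_{(\alpha_1,\dots,\alpha_n)}\le_W s^{\oplus_n}_{\alpha_1,\dots,\alpha_n}$ and $s^{\oplus_n}_{\alpha_1,\dots,\alpha_n}\not\le_W s_{(\alpha_1,\dots,\alpha_n)}$.
   Context: Cantor space $2^\omega$ carries the lexicographic order $<_{lex}$. For $\alpha\in2^\omega$, $s_\alpha(x)=0$ if $x<_{lex}\alpha$ and $1$ otherwise. A sequence is proper if it contains infinitely many $1$'s. For $\alpha_1<_{lex}\dots<_{lex}\alpha_n$, $s_{(\alpha_1,\dots,\alpha_n)}\colon2^\omega\to\{0,\dots,n\}$ maps $x$ to $0$ if $x<_{lex}\alpha_1$, to $j$ if $\alpha_j\le_{lex}x<_{lex}\alpha_{j+1}$ ($1\le j<n$), and to $n$ if $\alpha_n\le_{lex}x$. $s^{\oplus_n}_{\alpha_1,\dots,\alpha_n}\colon(2^\omega)^n\to\{0,1\}$ is $(x_1,\dots,x_n)\mapsto s_{\alpha_1}(x_1)\oplus\dots\oplus s_{\alpha_n}(x_n)$ (addition modulo 2). $f\le_W g$ means there are computable functionals $\Phi,\Psi$ with $f(x)=\Psi(x,g(\Phi(x)))$ for all $x$. -}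

module Defs where

open import Data.Nat using (ℕ; zero; suc; _<_; _≤_; _/_)
open import Data.Nat.DivMod using (_mod_)
open import Data.Fin using (Fin; toℕ) renaming (zero to fzero; suc to fsuc)
open import Data.Vec using (Vec; []; _∷_)
open import Data.Bool using (Bool; true; false; _xor_; if_then_else_)
open import Data.Product using (Σ; ∃; _×_; _,_)
open import Data.Sum using (_⊎_)
open import Relation.Binary.PropositionalEquality using (_≡_)
open import Level using (Level; _⊔_) renaming (suc to lsuc; zero to lzero)

Cantor : Set
Cantor = ℕ → Bool

zeros : Cantor
zeros _ = false

ones : Cantor
ones _ = true

_<lex_ : Cantor → Cantor → Set
x <lex y = ∃ λ k → (∀ i → i < k → x i ≡ y i) × (x k ≡ false) × (y k ≡ true)

_≈C_ : Cantor → Cantor → Set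
x ≈C y = ∀ i → x i ≡ y i

_≤lex_ : Cantor → Cantor → Set
x ≤lex y = (x <lex y) ⊎ (x ≈C y)

Proper : Cantor → Set
Proper α = ∀ m → ∃ λ k → m ≤ k × α k ≡ true

bitN : Bool → ℕ
bitN true = 1
bitN false = 0

SGraph : Cantor → Cantor → Bool → Set
SGraph α x b = (b ≡ false × x <lex α) ⊎ (b ≡ true × α ≤lex x)

-- graph of s_(α_1,...,α_n) : 2^ω → {0,...,n}; α (k) is α_{k+1}
SSeqGraph : (n : ℕ) → (Fin n → Cantor) → Cantor → ℕ → Set
SSeqGraph n α x j =
  j ≤ n
  × ((j ≡ 0) ⊎ Σ (Fin n) (λ k → suc (toℕ k) ≡ j × α k ≤lex x))
  × ((j ≡ n) ⊎ Σ (Fin n) (λ k → toℕ k ≡ j × x <lex α k))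

xorAll : ∀ {n} → (Fin n → Bool) → Bool
xorAll {zero} bs = false
xorAll {suc n} bs = bs fzero xor xorAll (λ i → bs (fsuc i))

SXorGraph : (n : ℕ) → (Fin n → Cantor) → (Fin n → Cantor) → ℕ → Set
SXorGraph n α xs v =
  Σ (Fin n → Bool) λ bs → (∀ i → SGraph (α i) (xs i) (bs i)) × (v ≡ bitN (xorAll bs))

-- Oracle partial recursive functions (Kleene), as a model of
-- computable functionals on Baire space ℕ → ℕ.

data Code : ℕ → Set where
  zer  : ∀ {k} → Code k
  succ : Code 1
  proj : ∀ {k} → Fin k → Code k
  orc  : Code 1
  comp : ∀ {k m} → Code m → Vec (Code k) m → Code k
  prec : ∀ {k} → Code k → Code (suc (suc k)) → Code (suc k)
  mu   : ∀ {k} → Code (suc k) → Code k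

lookupV : ∀ {A : Set} {k} → Vec A k → Fin k → A
lookupV (a ∷ _) fzero = a
lookupV (_ ∷ as) (fsuc i) = lookupV as i

mutual
  data Eval (o : ℕ → ℕ) : ∀ {k} → Code k → Vec ℕ k → ℕ → Set where
    ev-zer  : ∀ {k} {xs : Vec ℕ k} → Eval o zer xs 0
    ev-succ : ∀ {x} → Eval o succ (x ∷ []) (suc x)
    ev-proj : ∀ {k} {xs : Vec ℕ k} (i : Fin k) → Eval o (proj i) xs (lookupV xs i)
    ev-orc  : ∀ {x} → Eval o orc (x ∷ []) (o x)
    ev-comp : ∀ {k m} {f : Code m} {gs : Vec (Code k) m} {xs : Vec ℕ k}
                {ys : Vec ℕ m} {v : ℕ} →
              EvalAll o gs xs ys → Eval o f ys v → Eval o (comp f gs) xs v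
    ev-prec0 : ∀ {k} {g : Code k} {h : Code (suc (suc k))} {xs : Vec ℕ k} {v} →
               Eval o g xs v → Eval o (prec g h) (0 ∷ xs) v
    ev-precS : ∀ {k} {g : Code k} {h : Code (suc (suc k))} {xs : Vec ℕ k} {y w v} →
               Eval o (prec g h) (y ∷ xs) w → Eval o h (y ∷ w ∷ xs) v →
               Eval o (prec g h) (suc y ∷ xs) v
    ev-mu   : ∀ {k} {f : Code (suc k)} {xs : Vec ℕ k} {y} →
              Eval o f (y ∷ xs) 0 →
              (∀ z → z < y → Σ ℕ λ w → Eval o f (z ∷ xs) (suc w)) →
              Eval o (mu f) xs y

  data EvalAll (o : ℕ → ℕ) {k : ℕ} : ∀ {m} → Vec (Code k) m → Vec ℕ k → Vec ℕ m → Set where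
    ev-[] : ∀ {xs} → EvalAll o [] xs []
    ev-∷  : ∀ {m} {g : Code k} {gs : Vec (Code k) m} {xs y ys} →
            Eval o g xs y → EvalAll o gs xs ys → EvalAll o (g ∷ gs) xs (y ∷ ys)

record Problem : Set₁ where
  field
    Dom  : Set
    name : Dom → (ℕ → ℕ)        -- representation by elements of Baire space
    Rel  : Dom → ℕ → Set

open Problem public

-- f ≤_W g : computable Φ, Ψ with f(x) = Ψ(x, g(Φ(x))) for all x
_≤W_ : Problem → Problem → Set
f ≤W g =
  Σ (Code 1) λ eΦ → Σ (Code 1) λ eΨ →
    ∀ (x : Dom f) → Σ (Dom g) λ y →
      (∀ k → Eval (name f x) eΦ (k ∷ []) (name g y k))
      × (∀ b → Rel g y b →
           Σ ℕ λ v → Eval (name f x) eΨ (b ∷ []) v × Rel f x v)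

cantorName : Cantor → (ℕ → ℕ)
cantorName x k = bitN (x k)

tupleName : (n : ℕ) → (Fin n → Cantor) → (ℕ → ℕ)
tupleName zero xs m = 0
tupleName (suc n) xs m = bitN (xs (m mod suc n) (m / suc n))

sSeq : (n : ℕ) → (Fin n → Cantor) → Problem
sSeq n α = record { Dom = Cantor ; name = cantorName ; Rel = SSeqGraph n α }

sXor : (n : ℕ) → (Fin n → Cantor) → Problem
sXor n α = record { Dom = Fin n → Cantor ; name = tupleName n ; Rel = SXorGraph n α }

{-# OPTIONS --safe #-}
module Submission where

-- The reduction: a prefix of x of length L, where L separates the αᵢ, decides every comparison
-- x <lex αᵢ except for the (at most one) αᵢ sharing this prefix. Φ(x) puts x in coordinate i of that
-- αᵢ and 0^ω in all other coordinates, where s_{α_c} vanishes as 0^ω <lex α_c; so the oracle returns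
-- s_{αᵢ}(x), which settles the remaining comparison.
--
-- The non-reduction: if xᵢ = αᵢ, clearing a 1 of xᵢ far out (αᵢ is proper) flips the xor, so Ψ
-- must receive another value of s_(α), while by continuity Φ(x) changes only beyond any prescribed
-- length. Two points with a long common prefix and different values of s_(α) have some αₖ between
-- them, which forces Φ(x) = αₖ for some k. Doing this for x = α and then for α with coordinate i₀
-- perturbed (which still has coordinate i₁ equal to α_{i₁}; here n ≥ 2 is used) gives two tuples
-- that Φ sends to the same αₖ although their s_(α)-values differ. Comparisons in Cantor space are
-- undecidable, so this half is argued in the double-negation monad.

open import Defs
open import Data.Bool using (Bool; true; false; not; _xor_; if_then_else_)
import Data.Bool.Properties as Bool
open import Data.Empty using (⊥; ⊥-elim)
open import Data.Fin using (Fin; zero; suc; toℕ) renaming (_<_ to _<ᶠ_)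
import Data.Fin.Properties as Fin
open import Data.List using (List; []; _∷_)
open import Data.Nat using (ℕ; zero; suc; _≤_; _<_; _+_; _*_; _⊔_; _%_; _/_; z≤n; s≤s; s≤s⁻¹; NonZero)
open import Data.Nat.DivMod
  using (_mod_; m/n≤m; m%n<n; m≡m%n+[m/n]*n; [m+kn]%n≡m%n; +-distrib-/-∣ʳ; m*n/n≡m)
open import Data.Nat.Divisibility using (n∣m*n)
open import Data.Nat.Properties
  using (≤-refl; <-trans; <-≤-trans; ≤-<-trans; <⇒≢; <⇒≱; ≮⇒≥; n≮0; <-cmp; +-identityʳ; +-suc;
         m≤m⊔n; m≤n⊔m; m≤n⇒m≤1+n; m<1+n⇒m<n∨m≡n; m≤n⇒m<n∨m≡n; 0≢1+n; _<?_; _≟_)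
open import Data.Product using (Σ; ∃; _×_; _,_; proj₁; proj₂; map₂)
open import Data.Sum as Sum using (_⊎_; inj₁; inj₂)
open import Data.Vec using (Vec; []; _∷_)
open import Data.Vec.Functional using (updateAt)
open import Data.Vec.Functional.Properties using (updateAt-updates; updateAt-minimal)
open import Effect.Monad using (RawMonad)
open import Function using (_∘_; _$_; id)
open import Level using (0ℓ)
open import Relation.Binary using (tri<; tri≈; tri>)
open import Relation.Binary.PropositionalEquality
  using (_≡_; _≢_; refl; sym; trans; cong; cong₂; subst; module ≡-Reasoning)
open import Relation.Nullary using (¬_; Dec; yes; no; contradiction)
open import Relation.Nullary.Decidable using (decidable-stable; ¬¬-excluded-middle)
open import Relation.Nullary.Negation using (¬¬-Monad; ¬¬-map)

open RawMonad (¬¬-Monad {0ℓ}) using (_>>=_; return)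

Agree : {A : Set} → ℕ → (ℕ → A) → (ℕ → A) → Set
Agree M x y = ∀ i → i < M → x i ≡ y i

agree-sym : ∀ {A M} {x y : ℕ → A} → Agree M x y → Agree M y x
agree-sym ag i i<M = sym (ag i i<M)

agree-trans : ∀ {A M} {x y z : ℕ → A} → Agree M x y → Agree M y z → Agree M x z
agree-trans ag ag′ i i<M = trans (ag i i<M) (ag′ i i<M)

agree-mono : ∀ {A M N} {x y : ℕ → A} → M ≤ N → Agree N x y → Agree M x y
agree-mono M≤N ag i i<M = ag i (<-≤-trans i<M M≤N)

agree-suc : ∀ {A M} {x y : ℕ → A} → Agree M x y → x M ≡ y M → Agree (suc M) x y
agree-suc {M = M} ag e i i<1+M with m<1+n⇒m<n∨m≡n i<1+M
... | inj₁ i<M = ag i i<M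
... | inj₂ refl = e

true≢false : true ≢ false
true≢false ()

<lex-irrefl : ∀ {x y} → x <lex y → ¬ (x ≈C y)
<lex-irrefl (k , _ , xk , yk) x≈y = true≢false (trans (sym yk) (trans (sym (x≈y k)) xk))

<lex-asym : ∀ {x y} → x <lex y → ¬ (y <lex x)
<lex-asym (k , ag , xk , yk) (k′ , ag′ , yk′ , xk′) with <-cmp k k′
... | tri< k<k′ _ _ = true≢false (trans (sym yk) (trans (ag′ k k<k′) xk))
... | tri≈ _ refl _ = true≢false (trans (sym xk′) xk)
... | tri> _ _ k′<k = true≢false (trans (sym xk′) (trans (ag k′ k′<k) yk′))

<lex-trans : ∀ {x y z} → x <lex y → y <lex z → x <lex z
<lex-trans (k , ag , xk , yk) (k′ , ag′ , yk′ , zk′) with <-cmp k k′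
... | tri< k<k′ _ _ =
  k , (λ i i<k → trans (ag i i<k) (ag′ i (<-trans i<k k<k′))) , xk , trans (sym (ag′ k k<k′)) yk
... | tri≈ _ refl _ = ⊥-elim (true≢false (trans (sym yk) yk′))
... | tri> _ _ k′<k =
  k′ , (λ i i<k′ → trans (ag i (<-trans i<k′ k′<k)) (ag′ i i<k′)) , trans (ag k′ k′<k) yk′ , zk′

<lex-respʳ-≈C : ∀ {x y z} → x <lex y → y ≈C z → x <lex z
<lex-respʳ-≈C (k , ag , xk , yk) y≈z = k , (λ i i<k → trans (ag i i<k) (y≈z i)) , xk , trans (sym (y≈z k)) yk

<lex-respˡ-≈C : ∀ {x y z} → x ≈C y → y <lex z → x <lex z
<lex-respˡ-≈C x≈y (k , ag , yk , zk) = k , (λ i i<k → trans (x≈y i) (ag i i<k)) , trans (x≈y k) yk , zk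

≤lex-respʳ-≈C : ∀ {x y z} → x ≤lex y → y ≈C z → x ≤lex z
≤lex-respʳ-≈C (inj₁ x<y) y≈z = inj₁ (<lex-respʳ-≈C x<y y≈z)
≤lex-respʳ-≈C (inj₂ x≈y) y≈z = inj₂ (λ i → trans (x≈y i) (y≈z i))

<-≤lex-trans : ∀ {x y z} → x <lex y → y ≤lex z → x <lex z
<-≤lex-trans x<y (inj₁ y<z) = <lex-trans x<y y<z
<-≤lex-trans x<y (inj₂ y≈z) = <lex-respʳ-≈C x<y y≈z

≤lex-trans : ∀ {x y z} → x ≤lex y → y ≤lex z → x ≤lex z
≤lex-trans (inj₁ x<y) y≤z = inj₁ (<-≤lex-trans x<y y≤z)
≤lex-trans (inj₂ x≈y) (inj₁ y<z) = inj₁ (<lex-respˡ-≈C x≈y y<z)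
≤lex-trans (inj₂ x≈y) (inj₂ y≈z) = inj₂ (λ i → trans (x≈y i) (y≈z i))

<lex⇒≱lex : ∀ {x y} → x <lex y → ¬ (y ≤lex x)
<lex⇒≱lex x<y (inj₁ y<x) = <lex-asym x<y y<x
<lex⇒≱lex x<y (inj₂ y≈x) = <lex-irrefl x<y (λ i → sym (y≈x i))

agree-between : ∀ {M y z y′} → y <lex z → z ≤lex y′ → Agree M y y′ → Agree M z y
agree-between {M} {y} {z} {y′} (k , ag , yk , zk) z≤y′ y~y′ with k <? M
... | no k≮M = λ i i<M → sym (ag i (<-≤-trans i<M (≮⇒≥ k≮M)))
... | yes k<M = contradiction z≤y′ (<lex⇒≱lex y′<z)
  where
  y′<z : y′ <lex z
  y′<z = k , (λ i i<k → trans (sym (y~y′ i (<-trans i<k k<M))) (ag i i<k)) , trans (sym (y~y′ k k<M)) yk , zk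

data Comparison : Set where
  less equal greater : Comparison

compareBit : Bool → Bool → Comparison → Comparison
compareBit false true  _ = less
compareBit true  false _ = greater
compareBit false false c = c
compareBit true  true  c = c

prefix : ℕ → ℕ → Cantor → List Bool
prefix p zero    x = []
prefix p (suc d) x = x p ∷ prefix (suc p) d x

-- The word is read as the bits at positions p, p + 1, … .
comparePrefix : ℕ → List Bool → Cantor → Comparison
comparePrefix p []      a = equal
comparePrefix p (b ∷ w) a = compareBit b (a p) (comparePrefix (suc p) w a)

CompareSpec : Comparison → ℕ → Cantor → Cantor → Set
CompareSpec less    M x a = x <lex a
CompareSpec equal   M x a = Agree M x a
CompareSpec greater M x a = a <lex x

comparePrefix-sound : ∀ p d x a → Agree p x a →
                      CompareSpec (comparePrefix p (prefix p d x) a) (p + d) x a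
comparePrefix-sound p zero x a ag = subst (λ M → Agree M x a) (sym (+-identityʳ p)) ag
comparePrefix-sound p (suc d) x a ag = step (x p) (a p) refl refl
  where
  rest : Comparison
  rest = comparePrefix (suc p) (prefix (suc p) d x) a
  continue : x p ≡ a p → CompareSpec rest (p + suc d) x a
  continue e = subst (λ M → CompareSpec rest M x a) (sym (+-suc p d))
                     (comparePrefix-sound (suc p) d x a (agree-suc ag e))
  step : ∀ b c → x p ≡ b → a p ≡ c → CompareSpec (compareBit b c rest) (p + suc d) x a
  step false true  xp ap = p , ag , xp , ap
  step true  false xp ap = p , agree-sym ag , ap , xp
  step false false xp ap = continue (trans xp (sym ap))
  step true  true  xp ap = continue (trans xp (sym ap))

Side : Bool → Cantor → Cantor → Set
Side true  y a = y <lex a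
Side false y a = a ≤lex y

¬¬-apart-or-≈C : ∀ x y → ¬ ¬ ((∃ λ D → x D ≢ y D) ⊎ x ≈C y)
¬¬-apart-or-≈C x y = ¬¬-map decide ¬¬-excluded-middle
  where
  decide : Dec (∃ λ D → x D ≢ y D) → (∃ λ D → x D ≢ y D) ⊎ x ≈C y
  decide (yes apart) = inj₁ apart
  decide (no ¬apart) = inj₂ λ i → decidable-stable (x i Bool.≟ y i) (λ ne → ¬apart (i , ne))

agreement-length : ∀ x y → ¬ ¬ (∃ λ D → Agree D x y → x ≈C y)
agreement-length x y = ¬¬-map length (¬¬-apart-or-≈C x y)
  where
  length : (∃ λ D → x D ≢ y D) ⊎ x ≈C y → ∃ λ D → Agree D x y → x ≈C y
  length (inj₁ (D , ne)) = suc D , λ ag → contradiction (ag D ≤-refl) ne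
  length (inj₂ x≈y)      = 0 , λ _ → x≈y

¬¬-side : ∀ y a → ¬ ¬ (Σ Bool λ b → Side b y a)
¬¬-side y a = ¬¬-map side (¬¬-apart-or-≈C y a)
  where
  side : (∃ λ D → y D ≢ a D) ⊎ y ≈C a → Σ Bool λ b → Side b y a
  side (inj₂ y≈a) = false , inj₂ (λ i → sym (y≈a i))
  side (inj₁ (D , ne)) = decide _ (comparePrefix-sound 0 (suc D) y a (λ _ ()))
    where
    decide : ∀ c → CompareSpec c (suc D) y a → Σ Bool λ b → Side b y a
    decide less    y<a = true , y<a
    decide greater a<y = false , inj₁ a<y
    decide equal   ag  = contradiction (ag D ≤-refl) ne

¬¬-Π-Fin : ∀ {n} {P : Fin n → Set} → (∀ i → ¬ ¬ P i) → ¬ ¬ (∀ i → P i)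
¬¬-Π-Fin {zero}  _ = return λ ()
¬¬-Π-Fin {suc n} h = do
  p₀ ← h zero
  ps ← ¬¬-Π-Fin (h ∘ suc)
  return λ { zero → p₀ ; (suc i) → ps i }

Fin-bound : ∀ {n} {Q : Fin n → ℕ → Set} → (∀ {i D M} → D ≤ M → Q i D → Q i M) →
            (∀ i → ∃ (Q i)) → ∃ λ M → ∀ i → Q i M
Fin-bound {zero}  mono h = 0 , λ ()
Fin-bound {suc n} mono h with h zero | Fin-bound mono (h ∘ suc)
... | D , q | M , qs = D ⊔ M , λ { zero → mono (m≤m⊔n D M) q ; (suc i) → mono (m≤n⊔m D M) (qs i) }

<lex-length : ∀ {x y} → x <lex y → ∃ λ D → ¬ Agree D x y
<lex-length (k , _ , xk , yk) = suc k , λ ag → true≢false (trans (sym yk) (trans (sym (ag k ≤-refl)) xk))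

separating-length : ∀ {n} {α : Fin n → Cantor} → (∀ i j → i <ᶠ j → α i <lex α j) →
                    ∃ λ L → ∀ i j → Agree L (α i) (α j) → i ≡ j
separating-length {α = α} increasing =
  Fin-bound (λ D≤M sep j ag → sep j (agree-mono D≤M ag))
            (λ i → Fin-bound (λ D≤M sep ag → sep (agree-mono D≤M ag)) (pair i))
  where
  pair : ∀ i j → ∃ λ D → Agree D (α i) (α j) → i ≡ j
  pair i j with Fin.<-cmp i j
  ... | tri≈ _ i≡j _ = 0 , λ _ → i≡j
  ... | tri< i<j _ _ = let (D , ¬ag) = <lex-length (increasing i j i<j) in
                       D , λ ag → contradiction ag ¬ag
  ... | tri> _ _ j<i = let (D , ¬ag) = <lex-length (increasing j i j<i) in
                       D , λ ag → contradiction (agree-sym ag) ¬ag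

bitN-injective : ∀ {a b} → bitN a ≡ bitN b → a ≡ b
bitN-injective {false} {false} _ = refl
bitN-injective {true}  {true}  _ = refl

xorAll-cong : ∀ {n} {bs bs′ : Fin n → Bool} → (∀ c → bs c ≡ bs′ c) → xorAll bs ≡ xorAll bs′
xorAll-cong {zero}  eq = refl
xorAll-cong {suc n} eq = cong₂ _xor_ (eq zero) (xorAll-cong (eq ∘ suc))

xorAll-false : ∀ {n} (bs : Fin n → Bool) → (∀ c → bs c ≡ false) → xorAll bs ≡ false
xorAll-false {zero}  bs all-false = refl
xorAll-false {suc n} bs all-false rewrite all-false zero = xorAll-false (bs ∘ suc) (all-false ∘ suc)

xorAll-single : ∀ {n} (bs : Fin n → Bool) i → (∀ c → c ≢ i → bs c ≡ false) → xorAll bs ≡ bs i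
xorAll-single bs zero others =
  trans (cong (bs zero xor_) (xorAll-false (bs ∘ suc) (λ c → others (suc c) λ ()))) (Bool.xor-identityʳ _)
xorAll-single bs (suc i) others rewrite others zero (λ ()) =
  xorAll-single (bs ∘ suc) i (λ c c≢i → others (suc c) (c≢i ∘ Fin.suc-injective))

xorAll-not : ∀ {n} (bs bs′ : Fin n → Bool) i → (∀ c → c ≢ i → bs′ c ≡ bs c) → bs′ i ≡ not (bs i) →
             xorAll bs′ ≡ not (xorAll bs)
xorAll-not bs bs′ zero others flipped = begin
  bs′ zero xor xorAll (bs′ ∘ suc)     ≡⟨ cong₂ _xor_ flipped (xorAll-cong (λ c → others (suc c) λ ())) ⟩
  not (bs zero) xor xorAll (bs ∘ suc) ≡⟨ sym (Bool.not-distribˡ-xor (bs zero) _) ⟩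
  not (xorAll bs)                     ∎
  where open ≡-Reasoning
xorAll-not bs bs′ (suc i) others flipped = begin
  bs′ zero xor xorAll (bs′ ∘ suc)     ≡⟨ cong₂ _xor_ (others zero λ ())
                                              (xorAll-not (bs ∘ suc) (bs′ ∘ suc) i
                                                (λ c c≢i → others (suc c) (c≢i ∘ Fin.suc-injective)) flipped) ⟩
  bs zero xor not (xorAll (bs ∘ suc)) ≡⟨ sym (Bool.not-distribʳ-xor (bs zero) _) ⟩
  not (xorAll bs)                     ∎
  where open ≡-Reasoning

SGraph-functional : ∀ {a x b b′} → SGraph a x b → SGraph a x b′ → b ≡ b′
SGraph-functional (inj₁ (refl , _))   (inj₁ (refl , _))   = refl
SGraph-functional (inj₂ (refl , _))   (inj₂ (refl , _))   = refl
SGraph-functional (inj₁ (refl , x<a)) (inj₂ (refl , a≤x)) = contradiction a≤x (<lex⇒≱lex x<a)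
SGraph-functional (inj₂ (refl , a≤x)) (inj₁ (refl , x<a)) = contradiction a≤x (<lex⇒≱lex x<a)

SGraph-resp-≈C : ∀ {a x x′ b} → x ≈C x′ → SGraph a x b → SGraph a x′ b
SGraph-resp-≈C x≈x′ (inj₁ (b≡0 , x<a)) = inj₁ (b≡0 , <lex-respˡ-≈C (λ i → sym (x≈x′ i)) x<a)
SGraph-resp-≈C x≈x′ (inj₂ (b≡1 , a≤x)) = inj₂ (b≡1 , ≤lex-respʳ-≈C a≤x x≈x′)

SGraph⇒Side : ∀ {a x b} → SGraph a x b → Side (not b) x a
SGraph⇒Side (inj₁ (refl , x<a)) = x<a
SGraph⇒Side (inj₂ (refl , a≤x)) = a≤x

firstTrue : ∀ {n} → (Fin n → Bool) → ℕ
firstTrue {zero}  d = 0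
firstTrue {suc n} d = if d zero then 0 else suc (firstTrue (d ∘ suc))

firstTrue-SSeqGraph : ∀ {n} (α : Fin n → Cantor) y (d : Fin n → Bool) →
                      (∀ i → Side (d i) y (α i)) → SSeqGraph n α y (firstTrue d)
firstTrue-SSeqGraph {zero}  α y d sides = z≤n , inj₁ refl , inj₁ refl
firstTrue-SSeqGraph {suc n} α y d sides with d zero | sides zero
... | true  | y<α₀ = z≤n , inj₁ refl , inj₂ (zero , refl , y<α₀)
... | false | α₀≤y with firstTrue-SSeqGraph (α ∘ suc) y (d ∘ suc) (sides ∘ suc)
...   | j≤n , lo , hi = s≤s j≤n , inj₂ (lo-suc lo) , hi-suc hi
  where
  j : ℕ
  j = firstTrue (d ∘ suc)
  lo-suc : (j ≡ 0) ⊎ Σ (Fin n) (λ k → suc (toℕ k) ≡ j × α (suc k) ≤lex y) →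
              Σ (Fin (suc n)) (λ k → suc (toℕ k) ≡ suc j × α k ≤lex y)
  lo-suc (inj₁ j≡0)            = zero , cong suc (sym j≡0) , α₀≤y
  lo-suc (inj₂ (k , e , αk≤y)) = suc k , cong suc e , αk≤y
  hi-suc : (j ≡ n) ⊎ Σ (Fin n) (λ k → toℕ k ≡ j × y <lex α (suc k)) →
              (suc j ≡ suc n) ⊎ Σ (Fin (suc n)) (λ k → toℕ k ≡ suc j × y <lex α k)
  hi-suc (inj₁ j≡n)            = inj₁ (cong suc j≡n)
  hi-suc (inj₂ (k , e , y<αk)) = inj₂ (suc k , cong suc e , y<αk)

SSeqGraph-¬¬total : ∀ n α y → ¬ ¬ ∃ (SSeqGraph n α y)
SSeqGraph-¬¬total n α y = do
  sides ← ¬¬-Π-Fin (λ i → ¬¬-side y (α i))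
  return (_ , firstTrue-SSeqGraph α y (proj₁ ∘ sides) (proj₂ ∘ sides))

SSeqGraph-resp-≈C : ∀ {n α y y′ j} → y ≈C y′ → SSeqGraph n α y j → SSeqGraph n α y′ j
SSeqGraph-resp-≈C y≈y′ (j≤n , lo , hi) =
  j≤n , Sum.map₂ (map₂ (map₂ (λ αk≤y → ≤lex-respʳ-≈C αk≤y y≈y′))) lo
      , Sum.map₂ (map₂ (map₂ (λ y<αk → <lex-respˡ-≈C (λ i → sym (y≈y′ i)) y<αk))) hi

module _ {n} {α : Fin n → Cantor} (increasing : ∀ i j → i <ᶠ j → α i <lex α j) where

  increasing-≤ : ∀ i j → toℕ i ≤ toℕ j → α i ≤lex α j
  increasing-≤ i j i≤j with m≤n⇒m<n∨m≡n i≤j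
  ... | inj₁ i<j = inj₁ (increasing i j i<j)
  ... | inj₂ i≡j with Fin.toℕ-injective i≡j
  ...   | refl = inj₂ (λ _ → refl)

  -- The αₖ with toℕ k = j lies between y and y′.
  α-between-< : ∀ {M y y′ j j′} → SSeqGraph n α y j → SSeqGraph n α y′ j′ → j < j′ →
                Agree M y y′ → ∃ λ k → Agree M (α k) y
  α-between-< (_ , _ , hi) (j′≤n , lo′ , _) j<j′ y~y′ with hi | lo′
  ... | inj₁ refl | _ = contradiction j′≤n (<⇒≱ j<j′)
  ... | _ | inj₁ refl = contradiction j<j′ n≮0
  ... | inj₂ (k , refl , y<αk) | inj₂ (k′ , refl , αk′≤y′) =
    k , agree-between y<αk (≤lex-trans (increasing-≤ k k′ (s≤s⁻¹ j<j′)) αk′≤y′) y~y′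

  α-between : ∀ {M y y′ j j′} → SSeqGraph n α y j → SSeqGraph n α y′ j′ → j ≢ j′ →
              Agree M y y′ → ∃ λ k → Agree M (α k) y
  α-between {j = j} {j′} g g′ j≢j′ y~y′ with <-cmp j j′
  ... | tri< j<j′ _ _ = α-between-< g g′ j<j′ y~y′
  ... | tri≈ _ j≡j′ _ = contradiction j≡j′ j≢j′
  ... | tri> _ _ j′<j = let (k , αk~y′) = α-between-< g′ g j′<j (agree-sym y~y′) in
                        k , agree-trans αk~y′ (agree-sym y~y′)

-- The use of a halting computation: one more than the largest oracle query it makes.
mutual
  use : ∀ {o k} {e : Code k} {xs v} → Eval o e xs v → ℕ
  use ev-zer            = 0
  use ev-succ           = 0
  use (ev-proj i)       = 0
  use (ev-orc {x})      = suc x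
  use (ev-comp evs ev)  = useAll evs ⊔ use ev
  use (ev-prec0 ev)     = use ev
  use (ev-precS ev ev′) = use ev ⊔ use ev′
  use (ev-mu {y = y} ev evs) = use ev ⊔ useMu y evs

  useMu : ∀ {o k} {e : Code (suc k)} {xs} y →
          (∀ z → z < y → Σ ℕ λ w → Eval o e (z ∷ xs) (suc w)) → ℕ
  useMu zero    evs = 0
  useMu (suc y) evs = use (proj₂ (evs y ≤-refl)) ⊔ useMu y (λ z z<y → evs z (m≤n⇒m≤1+n z<y))

  useAll : ∀ {o k m} {es : Vec (Code k) m} {xs ys} → EvalAll o es xs ys → ℕ
  useAll ev-[]         = 0
  useAll (ev-∷ ev evs) = use ev ⊔ useAll evs

mutual
  eval-oracle-local : ∀ {o o′ k} {e : Code k} {xs v} (ev : Eval o e xs v) →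
                      Agree (use ev) o o′ → Eval o′ e xs v
  eval-oracle-local ev-zer         ag = ev-zer
  eval-oracle-local ev-succ        ag = ev-succ
  eval-oracle-local (ev-proj i)    ag = ev-proj i
  eval-oracle-local {o′ = o′} (ev-orc {x}) ag = subst (Eval o′ orc (x ∷ [])) (sym (ag x ≤-refl)) ev-orc
  eval-oracle-local (ev-comp evs ev) ag =
    ev-comp (evalAll-oracle-local evs (agree-mono (m≤m⊔n _ _) ag))
            (eval-oracle-local ev (agree-mono (m≤n⊔m _ _) ag))
  eval-oracle-local (ev-prec0 ev)  ag = ev-prec0 (eval-oracle-local ev ag)
  eval-oracle-local (ev-precS ev ev′) ag =
    ev-precS (eval-oracle-local ev (agree-mono (m≤m⊔n _ _) ag))
             (eval-oracle-local ev′ (agree-mono (m≤n⊔m _ _) ag))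
  eval-oracle-local (ev-mu {y = y} ev evs) ag =
    ev-mu (eval-oracle-local ev (agree-mono (m≤m⊔n _ _) ag))
          (evalMu-oracle-local y evs (agree-mono (m≤n⊔m _ _) ag))

  evalMu-oracle-local : ∀ {o o′ k} {e : Code (suc k)} {xs} y →
    (evs : ∀ z → z < y → Σ ℕ λ w → Eval o e (z ∷ xs) (suc w)) → Agree (useMu y evs) o o′ →
    ∀ z → z < y → Σ ℕ λ w → Eval o′ e (z ∷ xs) (suc w)
  evalMu-oracle-local (suc y) evs ag z z<1+y with m<1+n⇒m<n∨m≡n z<1+y
  ... | inj₁ z<y  =
    evalMu-oracle-local y (λ z z<y → evs z (m≤n⇒m≤1+n z<y)) (agree-mono (m≤n⊔m _ _) ag) z z<y
  ... | inj₂ refl =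
    proj₁ (evs z ≤-refl) , eval-oracle-local (proj₂ (evs z ≤-refl)) (agree-mono (m≤m⊔n _ _) ag)

  evalAll-oracle-local : ∀ {o o′ k m} {es : Vec (Code k) m} {xs ys} (evs : EvalAll o es xs ys) →
                         Agree (useAll evs) o o′ → EvalAll o′ es xs ys
  evalAll-oracle-local ev-[]         ag = ev-[]
  evalAll-oracle-local (ev-∷ ev evs) ag =
    ev-∷ (eval-oracle-local ev (agree-mono (m≤m⊔n _ _) ag))
         (evalAll-oracle-local evs (agree-mono (m≤n⊔m _ _) ag))

mutual
  eval-deterministic : ∀ {o k} {e : Code k} {xs v v′} → Eval o e xs v → Eval o e xs v′ → v ≡ v′
  eval-deterministic ev-zer ev-zer = refl
  eval-deterministic ev-succ ev-succ = refl
  eval-deterministic (ev-proj i) (ev-proj .i) = refl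
  eval-deterministic ev-orc ev-orc = refl
  eval-deterministic (ev-comp evs ev) (ev-comp evs′ ev′) with evalAll-deterministic evs evs′
  ... | refl = eval-deterministic ev ev′
  eval-deterministic (ev-prec0 ev) (ev-prec0 ev′) = eval-deterministic ev ev′
  eval-deterministic (ev-precS ev h) (ev-precS ev′ h′) with eval-deterministic ev ev′
  ... | refl = eval-deterministic h h′
  eval-deterministic (ev-mu {y = y} ev evs) (ev-mu {y = y′} ev′ evs′) with <-cmp y y′
  ... | tri< y<y′ _ _ = contradiction (eval-deterministic ev (proj₂ (evs′ y y<y′))) 0≢1+n
  ... | tri≈ _ y≡y′ _ = y≡y′
  ... | tri> _ _ y′<y = contradiction (eval-deterministic ev′ (proj₂ (evs y′ y′<y))) 0≢1+n

  evalAll-deterministic : ∀ {o k m} {es : Vec (Code k) m} {xs ys ys′} →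
                          EvalAll o es xs ys → EvalAll o es xs ys′ → ys ≡ ys′
  evalAll-deterministic ev-[] ev-[] = refl
  evalAll-deterministic (ev-∷ ev evs) (ev-∷ ev′ evs′) =
    cong₂ _∷_ (eval-deterministic ev ev′) (evalAll-deterministic evs evs′)

eval-prefix-local : ∀ {o} {e : Code 1} {f : ℕ → ℕ} → (ev : ∀ k → Eval o e (k ∷ []) (f k)) → ∀ M →
                    ∃ λ U → ∀ {o′} → Agree U o o′ → ∀ k → k < M → Eval o′ e (k ∷ []) (f k)
eval-prefix-local ev zero = 0 , λ _ k ()
eval-prefix-local {o} {e} {f} ev (suc M) with eval-prefix-local ev M
... | U , local = use (ev M) ⊔ U , local′
  where
  local′ : ∀ {o′} → Agree (use (ev M) ⊔ U) o o′ → ∀ k → k < suc M → Eval o′ e (k ∷ []) (f k)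
  local′ ag k k<1+M with m<1+n⇒m<n∨m≡n k<1+M
  ... | inj₁ k<M  = local (agree-mono (m≤n⊔m _ _) ag) k k<M
  ... | inj₂ refl = eval-oracle-local (ev M) (agree-mono (m≤m⊔n _ _) ag)

constᶜ : ∀ {k} → ℕ → Code k
constᶜ zero    = zer
constᶜ (suc c) = comp succ (constᶜ c ∷ [])

constᶜ-ev : ∀ {o k} {xs : Vec ℕ k} c → Eval o (constᶜ c) xs c
constᶜ-ev zero    = ev-zer
constᶜ-ev (suc c) = ev-comp (ev-∷ (constᶜ-ev c) ev-[]) ev-succ

_∘ᶜ_ : ∀ {k} → Code 1 → Code k → Code k
f ∘ᶜ g = comp f (g ∷ [])

∘ᶜ-ev : ∀ {o k} {f : Code 1} {g : Code k} {xs u v} →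
        Eval o g xs u → Eval o f (u ∷ []) v → Eval o (f ∘ᶜ g) xs v
∘ᶜ-ev g-ev f-ev = ev-comp (ev-∷ g-ev ev-[]) f-ev

prec-ev : ∀ {o k} {g : Code k} {h : Code (suc (suc k))} {xs} (f : ℕ → ℕ) →
          Eval o g xs (f 0) → (∀ y → Eval o h (y ∷ f y ∷ xs) (f (suc y))) →
          ∀ y → Eval o (prec g h) (y ∷ xs) (f y)
prec-ev f g-ev h-ev zero    = ev-prec0 g-ev
prec-ev f g-ev h-ev (suc y) = ev-precS (prec-ev f g-ev h-ev y) (h-ev y)

table : ∀ {B} → (Fin B → ℕ) → ℕ → ℕ
table {zero}  t c       = 0
table {suc B} t zero    = t zero
table {suc B} t (suc c) = table (t ∘ suc) c

table-% : ∀ {N} .{{_ : NonZero N}} (t : Fin N → ℕ) k → table t (k % N) ≡ t (k mod N)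
table-% {N} t k = trans (cong (table t) (sym (Fin.toℕ-fromℕ< (m%n<n k N)))) (table-toℕ t (k mod N))
  where
  table-toℕ : ∀ {B} (t : Fin B → ℕ) i → table t (toℕ i) ≡ t i
  table-toℕ t zero    = refl
  table-toℕ t (suc i) = table-toℕ (t ∘ suc) i

tableᶜ : ∀ {B} → (Fin B → ℕ) → Code 1
tableᶜ {zero}  t = zer
tableᶜ {suc B} t = prec (constᶜ (t zero)) (tableᶜ (t ∘ suc) ∘ᶜ proj zero)

tableᶜ-ev : ∀ {o B} (t : Fin B → ℕ) c → Eval o (tableᶜ t) (c ∷ []) (table t c)
tableᶜ-ev {B = zero}  t c = ev-zer
tableᶜ-ev {B = suc B} t c =
  prec-ev (table t) (constᶜ-ev (t zero)) (λ y → ∘ᶜ-ev (ev-proj zero) (tableᶜ-ev (t ∘ suc) y)) c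

addᶜ : Code 2
addᶜ = prec (proj zero) (succ ∘ᶜ proj (suc zero))

addᶜ-ev : ∀ {o} a b → Eval o addᶜ (a ∷ b ∷ []) (a + b)
addᶜ-ev a b = prec-ev (_+ b) (ev-proj zero) (λ y → ∘ᶜ-ev (ev-proj (suc zero)) ev-succ) a

%-suc : ∀ y N .{{_ : NonZero N}} → suc y % N ≡ suc (y % N) % N
%-suc y N = begin
  suc y % N                       ≡⟨ cong (λ m → suc m % N) (m≡m%n+[m/n]*n y N) ⟩
  (suc (y % N) + y / N * N) % N   ≡⟨ [m+kn]%n≡m%n (suc (y % N)) (y / N) N ⟩
  suc (y % N) % N                 ∎
  where open ≡-Reasoning

/-suc : ∀ y N .{{_ : NonZero N}} → suc y / N ≡ suc (y % N) / N + y / N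
/-suc y N = begin
  suc y / N                       ≡⟨ cong (λ m → suc m / N) (m≡m%n+[m/n]*n y N) ⟩
  (suc (y % N) + y / N * N) / N   ≡⟨ +-distrib-/-∣ʳ (suc (y % N)) (n∣m*n (y / N)) ⟩
  suc (y % N) / N + y / N * N / N ≡⟨ cong (suc (y % N) / N +_) (m*n/n≡m (y / N) N) ⟩
  suc (y % N) / N + y / N         ∎
  where open ≡-Reasoning

module _ (N-1 : ℕ) where

  private
    N : ℕ
    N = suc N-1

  successor-mod : Fin N → ℕ
  successor-mod i = suc (toℕ i) % N

  modᶜ : Code 1
  modᶜ = prec zer (tableᶜ successor-mod ∘ᶜ proj (suc zero))

  modᶜ-ev : ∀ {o} k → Eval o modᶜ (k ∷ []) (k % N)
  modᶜ-ev {o} k = prec-ev (_% N) ev-zer step k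
    where
    step : ∀ y → Eval o (tableᶜ successor-mod ∘ᶜ proj (suc zero)) (y ∷ y % N ∷ []) (suc y % N)
    step y = ∘ᶜ-ev (ev-proj (suc zero)) (subst (Eval o (tableᶜ successor-mod) (y % N ∷ [])) next
                                              (tableᶜ-ev successor-mod (y % N)))
      where
      next : table successor-mod (y % N) ≡ suc y % N
      next = begin
        table successor-mod (y % N) ≡⟨ table-% successor-mod y ⟩
        suc (toℕ (y mod N)) % N     ≡⟨ cong (λ r → suc r % N) (Fin.toℕ-fromℕ< (m%n<n y N)) ⟩
        suc (y % N) % N             ≡⟨ sym (%-suc y N) ⟩
        suc y % N                   ∎
        where open ≡-Reasoning

  carry : Fin N → ℕ
  carry i = suc (toℕ i) / N

  divᶜ : Code 1
  divᶜ = prec zer (comp addᶜ (tableᶜ carry ∘ᶜ (modᶜ ∘ᶜ proj zero) ∷ proj (suc zero) ∷ []))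

  divᶜ-ev : ∀ {o} k → Eval o divᶜ (k ∷ []) (k / N)
  divᶜ-ev {o} k = prec-ev (_/ N) ev-zer step k
    where
    step : ∀ y → Eval o (comp addᶜ (tableᶜ carry ∘ᶜ (modᶜ ∘ᶜ proj zero) ∷ proj (suc zero) ∷ []))
                        (y ∷ y / N ∷ []) (suc y / N)
    step y = subst (Eval o _ (y ∷ y / N ∷ [])) next
      (ev-comp (ev-∷ (∘ᶜ-ev (∘ᶜ-ev (ev-proj zero) (modᶜ-ev y)) (tableᶜ-ev carry (y % N)))
                     (ev-∷ (ev-proj (suc zero)) ev-[]))
               (addᶜ-ev _ _))
      where
      next : table carry (y % N) + y / N ≡ suc y / N
      next = begin
        table carry (y % N) + y / N     ≡⟨ cong (_+ y / N) (table-% carry y) ⟩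
        suc (toℕ (y mod N)) / N + y / N ≡⟨ cong (λ r → suc r / N + y / N) (Fin.toℕ-fromℕ< (m%n<n y N)) ⟩
        suc (y % N) / N + y / N         ≡⟨ sym (/-suc y N) ⟩
        suc y / N                       ∎
        where open ≡-Reasoning

condᶜ : Code 1 → Code 1 → Code 1 → Code 1
condᶜ t a b = comp (prec a (b ∘ᶜ proj (suc (suc zero)))) (t ∷ proj zero ∷ [])

condᶜ-ev : ∀ {o t a b k u v} c → Eval o t (k ∷ []) (bitN c) → Eval o a (k ∷ []) u → Eval o b (k ∷ []) v →
           Eval o (condᶜ t a b) (k ∷ []) (if c then v else u)
condᶜ-ev false t-ev a-ev b-ev = ev-comp (ev-∷ t-ev (ev-∷ (ev-proj zero) ev-[])) (ev-prec0 a-ev)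
condᶜ-ev true  t-ev a-ev b-ev =
  ev-comp (ev-∷ t-ev (ev-∷ (ev-proj zero) ev-[])) (ev-precS (ev-prec0 a-ev) (∘ᶜ-ev (ev-proj _) b-ev))

prefixTreeᶜ : ℕ → ℕ → (List Bool → Code 1) → Code 1
prefixTreeᶜ p zero    F = F []
prefixTreeᶜ p (suc d) F =
  condᶜ (orc ∘ᶜ constᶜ p) (prefixTreeᶜ (suc p) d (F ∘ (false ∷_))) (prefixTreeᶜ (suc p) d (F ∘ (true ∷_)))

prefixTreeᶜ-ev : ∀ {x k} p d {F} (G : List Bool → ℕ) → (∀ w → Eval (cantorName x) (F w) (k ∷ []) (G w)) →
                 Eval (cantorName x) (prefixTreeᶜ p d F) (k ∷ []) (G (prefix p d x))
prefixTreeᶜ-ev p zero G ev = ev []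
prefixTreeᶜ-ev {x} {k} p (suc d) {F} G ev =
  subst (Eval (cantorName x) (prefixTreeᶜ p (suc d) F) (k ∷ [])) (read (x p))
        (condᶜ-ev (x p) (∘ᶜ-ev (constᶜ-ev p) ev-orc)
                  (prefixTreeᶜ-ev (suc p) d (G ∘ (false ∷_)) (ev ∘ (false ∷_)))
                  (prefixTreeᶜ-ev (suc p) d (G ∘ (true ∷_)) (ev ∘ (true ∷_))))
  where
  w : List Bool
  w = prefix (suc p) d x
  read : ∀ b → (if b then G (true ∷ w) else G (false ∷ w)) ≡ G (b ∷ w)
  read true  = refl
  read false = refl

-- s_(α) ≤W s^⊕

module Reduction {n} (α : Fin (suc n) → Cantor) (zeros<α : ∀ i → zeros <lex α i)
                 (L : ℕ) (separated : ∀ i j → Agree L (α i) (α j) → i ≡ j) where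

  isEqual : Comparison → Bool
  isEqual less    = false
  isEqual equal   = true
  isEqual greater = false

  matches : List Bool → Fin (suc n) → Bool
  matches w i = isEqual (comparePrefix 0 w (α i))

  Φ-point : Cantor → Fin (suc n) → Cantor
  Φ-point x i p = if matches (prefix 0 L x) i then x p else false

  Φ-leaf : List Bool → Code 1
  Φ-leaf w = condᶜ (tableᶜ (bitN ∘ matches w) ∘ᶜ modᶜ n) zer (orc ∘ᶜ divᶜ n)

  Φᶜ : Code 1
  Φᶜ = prefixTreeᶜ 0 L Φ-leaf

  Φᶜ-ev : ∀ x k → Eval (cantorName x) Φᶜ (k ∷ []) (tupleName (suc n) (Φ-point x) k)
  Φᶜ-ev x k = subst (Eval (cantorName x) Φᶜ (k ∷ []))
                    (sym (Bool.if-float bitN (matches (prefix 0 L x) (k mod suc n))))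
                    (prefixTreeᶜ-ev 0 L G leaf-ev)
    where
    G : List Bool → ℕ
    G w = if matches w (k mod suc n) then bitN (x (k / suc n)) else 0
    leaf-ev : ∀ w → Eval (cantorName x) (Φ-leaf w) (k ∷ []) (G w)
    leaf-ev w = condᶜ-ev (matches w (k mod suc n))
      (∘ᶜ-ev (modᶜ-ev n k) (subst (Eval _ (tableᶜ (bitN ∘ matches w)) (k % suc n ∷ []))
                                  (table-% (bitN ∘ matches w) k) (tableᶜ-ev (bitN ∘ matches w) (k % suc n))))
      ev-zer (∘ᶜ-ev (divᶜ-ev n k) ev-orc)

  below : Comparison → Bool → Bool
  below less    _ = true
  below equal   b = not b
  below greater _ = false

  Ψ-index : List Bool → Bool → ℕ
  Ψ-index w b = firstTrue (λ i → below (comparePrefix 0 w (α i)) b)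

  Ψ-leaf : List Bool → Code 1
  Ψ-leaf w = condᶜ (proj zero) (constᶜ (Ψ-index w false)) (constᶜ (Ψ-index w true))

  Ψᶜ : Code 1
  Ψᶜ = prefixTreeᶜ 0 L Ψ-leaf

  Ψᶜ-ev : ∀ x b → Eval (cantorName x) Ψᶜ (bitN b ∷ []) (Ψ-index (prefix 0 L x) b)
  Ψᶜ-ev x b = prefixTreeᶜ-ev 0 L (λ w → Ψ-index w b) leaf-ev
    where
    leaf-ev : ∀ w → Eval (cantorName x) (Ψ-leaf w) (bitN b ∷ []) (Ψ-index w b)
    leaf-ev w = subst (Eval _ (Ψ-leaf w) (bitN b ∷ [])) (read b)
                      (condᶜ-ev b (ev-proj zero) (constᶜ-ev _) (constᶜ-ev _))
      where
      read : ∀ b → (if b then Ψ-index w true else Ψ-index w false) ≡ Ψ-index w b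
      read true  = refl
      read false = refl

  module _ (x : Cantor) (bs : Fin (suc n) → Bool) (hs : ∀ c → SGraph (α c) (Φ-point x c) (bs c)) where

    π : List Bool
    π = prefix 0 L x

    xorAll-matched : ∀ i → comparePrefix 0 π (α i) ≡ equal → SGraph (α i) x (xorAll bs)
    xorAll-matched i matched = subst (SGraph (α i) x) (sym only-i) (SGraph-resp-≈C Φi≈x (hs i))
      where
      x~αi : Agree L x (α i)
      x~αi = subst (λ c → CompareSpec c L x (α i)) matched (comparePrefix-sound 0 L x (α i) (λ _ ()))
      Φi≈x : Φ-point x i ≈C x
      Φi≈x p = cong (λ b → if b then x p else false) (cong isEqual matched)
      unmatched : ∀ c → c ≢ i → isEqual (comparePrefix 0 π (α c)) ≡ false
      unmatched c c≢i with comparePrefix 0 π (α c) | comparePrefix-sound 0 L x (α c) (λ _ ())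
      ... | less    | _    = refl
      ... | greater | _    = refl
      ... | equal   | x~αc = contradiction (separated c i (agree-trans (agree-sym x~αc) x~αi)) c≢i
      Φc<αc : ∀ c → c ≢ i → Φ-point x c <lex α c
      Φc<αc c c≢i =
        <lex-respˡ-≈C (λ p → cong (λ b → if b then x p else false) (unmatched c c≢i)) (zeros<α c)
      only-i : xorAll bs ≡ bs i
      only-i = xorAll-single bs i λ c c≢i → SGraph-functional (hs c) (inj₁ (refl , Φc<αc c c≢i))

    side : ∀ i → Side (below (comparePrefix 0 π (α i)) (xorAll bs)) x (α i)
    side i with comparePrefix 0 π (α i) in e | comparePrefix-sound 0 L x (α i) (λ _ ())
    ... | less    | x<αi = x<αi
    ... | greater | αi<x = inj₁ αi<x
    ... | equal   | _    = SGraph⇒Side (xorAll-matched i e)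

  sSeq≤W-sXor : sSeq (suc n) α ≤W sXor (suc n) α
  sSeq≤W-sXor = Φᶜ , Ψᶜ , λ x → Φ-point x , Φᶜ-ev x , λ
    { _ (bs , hs , refl) → _ , Ψᶜ-ev x (xorAll bs) , firstTrue-SSeqGraph α x _ (side x bs hs) }

-- s^⊕ ≰W s_(α)

clearBit : ℕ → Cantor → Cantor
clearBit P a p with p ≟ P
... | yes _ = false
... | no  _ = a p

clearBit-agree : ∀ P a → Agree P (clearBit P a) a
clearBit-agree P a p p<P with p ≟ P
... | yes p≡P = contradiction p≡P (<⇒≢ p<P)
... | no  _   = refl

clearBit-<lex : ∀ P a → a P ≡ true → clearBit P a <lex a
clearBit-<lex P a aP = P , clearBit-agree P a , cleared , aP
  where
  cleared : clearBit P a P ≡ false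
  cleared with P ≟ P
  ... | yes _   = refl
  ... | no  P≢P = contradiction refl P≢P

lower : ∀ {n} → (Fin n → Cantor) → Fin n → ℕ → (Fin n → Cantor)
lower x i P = updateAt x i (clearBit P)

lower-agree : ∀ {n} (x : Fin n → Cantor) i P c → Agree P (x c) (lower x i P c)
lower-agree x i P c with c Fin.≟ i
... | yes refl = subst (Agree P (x c)) (sym (updateAt-updates c x)) (agree-sym (clearBit-agree P (x c)))
... | no  c≢i  = subst (Agree P (x c)) (sym (updateAt-minimal c i x c≢i)) (λ _ _ → refl)

tupleName-local : ∀ n {x x′ : Fin n → Cantor} N → (∀ c → Agree N (x c) (x′ c)) →
                  Agree N (tupleName n x) (tupleName n x′)
tupleName-local zero    N x~x′ q q<N = refl
tupleName-local (suc n) N x~x′ q q<N =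
  cong bitN (x~x′ (q mod suc n) (q / suc n) (≤-<-trans (m/n≤m q (suc n)) q<N))

-- Lowering a 1 of xᵢ = αᵢ puts xᵢ below αᵢ and so flips the xor.
SXorGraph-lower : ∀ {n α x i P v} → x i ≈C α i → α i P ≡ true →
                  SXorGraph n α x v → ¬ SXorGraph n α (lower x i P) v
SXorGraph-lower {n} {α} {x} {i} {P} x≈α αP (bs , hs , refl) (bs′ , hs′ , same) =
  Bool.not-¬ (sym (bitN-injective same)) (xorAll-not bs bs′ i others flipped)
  where
  others : ∀ c → c ≢ i → bs′ c ≡ bs c
  others c c≢i = SGraph-functional (hs′ c)
    (subst (λ y → SGraph (α c) y (bs c)) (sym (updateAt-minimal c i x c≢i)) (hs c))
  bs-i : bs i ≡ true
  bs-i = SGraph-functional (hs i) (inj₂ (refl , inj₂ (λ p → sym (x≈α p))))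
  lowered : lower x i P i <lex α i
  lowered = subst (_<lex α i) (sym (updateAt-updates i x))
                  (<lex-respʳ-≈C (clearBit-<lex P (x i) (trans (x≈α P) αP)) x≈α)
  flipped : bs′ i ≡ not (bs i)
  flipped = trans (SGraph-functional (hs′ i) (inj₁ (refl , lowered))) (cong not (sym bs-i))

module Obstruction {n} (α : Fin n → Cantor) (proper : ∀ i → Proper (α i))
                   (increasing : ∀ i j → i <ᶠ j → α i <lex α j) (red : sXor n α ≤W sSeq n α) where

  Φᶜ Ψᶜ : Code 1
  Φᶜ = proj₁ red
  Ψᶜ = proj₁ (proj₂ red)

  Φ : (Fin n → Cantor) → Cantor
  Φ x = proj₁ (proj₂ (proj₂ red) x)

  Φ-ev : ∀ x k → Eval (tupleName n x) Φᶜ (k ∷ []) (cantorName (Φ x) k)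
  Φ-ev x = proj₁ (proj₂ (proj₂ (proj₂ red) x))

  Ψ-run : ∀ x j → SSeqGraph n α (Φ x) j →
          Σ ℕ λ v → Eval (tupleName n x) Ψᶜ (j ∷ []) v × SXorGraph n α x v
  Ψ-run x = proj₂ (proj₂ (proj₂ (proj₂ red) x))

  -- Lower a 1 of αᵢ beyond the uses of Ψ on (x, j) and of Φ below M.
  lowering-moves-index : ∀ x i → x i ≈C α i → ∀ j → SSeqGraph n α (Φ x) j → ∀ M →
                         ∃ λ P → Agree M (Φ x) (Φ (lower x i P)) × ¬ SSeqGraph n α (Φ (lower x i P)) j
  lowering-moves-index x i x≈α j g M with Ψ-run x j g | eval-prefix-local (Φ-ev x) M
  ... | _ , Ψ-ev , rel | U , Φ-local with proper i (use Ψ-ev ⊔ U)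
  ...   | P , P-late , αP = P , Φ-agree , index-moves
    where
    x′ : Fin n → Cantor
    x′ = lower x i P
    names-agree : Agree (use Ψ-ev ⊔ U) (tupleName n x) (tupleName n x′)
    names-agree = tupleName-local n _ λ c → agree-mono P-late (lower-agree x i P c)
    Φ-agree : Agree M (Φ x) (Φ x′)
    Φ-agree k k<M =
      bitN-injective (eval-deterministic (Φ-local (agree-mono (m≤n⊔m _ _) names-agree) k k<M) (Φ-ev x′ k))
    index-moves : ¬ SSeqGraph n α (Φ x′) j
    index-moves g′ with Ψ-run x′ j g′
    ... | _ , Ψ-ev′ , rel′
      with eval-deterministic (eval-oracle-local Ψ-ev (agree-mono (m≤m⊔n _ _) names-agree)) Ψ-ev′
    ...   | refl = SXorGraph-lower x≈α αP rel rel′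

  lands-on-α : ∀ x i → x i ≈C α i → ¬ ¬ ∃ λ k → Φ x ≈C α k
  lands-on-α x i x≈α = do
    (j , g) ← SSeqGraph-¬¬total n α (Φ x)
    lengths ← ¬¬-Π-Fin (λ k → agreement-length (Φ x) (α k))
    let (M , close⇒≈) = Fin-bound (λ D≤M eq ag → eq (agree-mono D≤M ag)) lengths
        (P , Φ-agree , index-moves) = lowering-moves-index x i x≈α j g M
    (j′ , g′) ← SSeqGraph-¬¬total n α (Φ (lower x i P))
    let (k , αk~Φx) = α-between increasing g g′ (λ { refl → index-moves g′ }) Φ-agree
    return (k , close⇒≈ k (agree-sym αk~Φx))

  absurd : ∀ i₀ i₁ → i₁ ≢ i₀ → ¬ ¬ ⊥
  absurd i₀ i₁ i₁≢i₀ = do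
    let (L , separated) = separating-length increasing
    (k , Φα≈αk) ← lands-on-α α i₀ (λ _ → refl)
    (j , g) ← SSeqGraph-¬¬total n α (Φ α)
    let (P , Φ-agree , index-moves) = lowering-moves-index α i₀ (λ _ → refl) j g L
    (k′ , Φα′≈αk′) ← lands-on-α (lower α i₀ P) i₁ (λ p → cong (_$ p) (updateAt-minimal i₁ i₀ α i₁≢i₀))
    let k≡k′ = separated k k′ λ p p<L → trans (sym (Φα≈αk p)) (trans (Φ-agree p p<L) (Φα′≈αk′ p))
        Φα≈Φα′ = λ p → trans (Φα≈αk p) (trans (cong (λ k → α k p) k≡k′) (sym (Φα′≈αk′ p)))
    return (index-moves (SSeqGraph-resp-≈C Φα≈Φα′ g))

mainTheorem9 : (n : ℕ) → 2 ≤ n → (α : Fin n → Cantor)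
    → (∀ i → Proper (α i))
    → (∀ i → zeros <lex α i)
    → (∀ i j → i <ᶠ j → α i <lex α j)
    → (∀ i → α i <lex ones)
    → (sSeq n α ≤W sXor n α) × ¬ (sXor n α ≤W sSeq n α)
mainTheorem9 (suc (suc _)) (s≤s (s≤s z≤n)) α proper zeros<α increasing _ =
  let (L , separated) = separating-length increasing in
  Reduction.sSeq≤W-sXor α zeros<α L separated ,
  λ red → Obstruction.absurd α proper increasing red zero (suc zero) (λ ()) id
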